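{- Every 2-edge-colored hexagonal grid admits a homomorphism (of 2-edge-colored graphs) to the 2-edge-colored graph $\rho(T_4)$.
   Context: A 2-edge-colored graph $G=(V,E,s)$ is a finite simple graph with a signature $s:E\to\{ -1,+1\}$. A homomorphism of 2-edge-colored graphs $G\to H$ is a map $\varphi:V(G)\to V(H)$ such that for every edge $uv$ of $G$, $\varphi(u)\varphi(v)$ is an edge of $H$ with $s_H(\varphi(u)\varphi(v))=s_G(uv)$ (no switching allowed). $T_4$ is the 2-edge-colored complete graph on vertices $\{1,2,3,4\}$ in which the edge $14$ is negative and the edges $12,13,23,24,34$ are positive. For a 2-edge-colored graph $H$ with signature $s_H$, the antitwinned graph $\rho(H)$ has vertex set $\{v^{i}: v\in V(H),\ i\in\{ -1,+1\}\}$, edge set $\{u^iv^j: uv\in E(H),\ i,j\in\{ -1,+1\}\}$, and signature $s_{\rho(H)}(u^iv^j)=i\cdot j\cdot s_H(uv)$. A hexagonal grid is a finite induced subgraph of the graph of the tiling of the plane by regular hexagons; a 2-edge-colored hexagonal grid is such a graph with an arbitrary signature. -}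

module Defs where

open import Data.Integer using (ℤ; _+_; +_)
open import Data.Integer.Divisibility using (_∣_)
open import Data.Fin using (Fin; zero; suc)
open import Data.Product using (Σ; _×_; _,_)
open import Data.Sum using (_⊎_)
open import Data.List using (List)
open import Data.List.Membership.Propositional using (_∈_)
open import Relation.Binary.PropositionalEquality using (_≡_; _≢_)

data Sign : Set where
  pos neg : Sign

_·_ : Sign → Sign → Sign
pos · j = j
neg · pos = neg
neg · neg = pos

-- 2-edge-colored graphs (adjacency relation with a sign on each edge)

record SGraph : Set₁ where
  field
    V   : Set
    Adj : V → V → Set
    sgn : ∀ {u v} → Adj u v → Sign
open SGraph public

-- homomorphism of 2-edge-colored graphs (no switching)
IsHom : (G H : SGraph) → (V G → V H) → Set
IsHom G H φ = ∀ {u v} (e : Adj G u v) →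
  Σ (Adj H (φ u) (φ v)) (λ e′ → sgn H e′ ≡ sgn G e)

ρ : SGraph → SGraph
ρ H = record
  { V   = V H × Sign
  ; Adj = λ { (u , i) (v , j) → Adj H u v }
  ; sgn = λ { {u , i} {v , j} e → (i · j) · sgn H e }
  }

-- T₄ : complete graph on {1,2,3,4} (here Fin 4 = {0,1,2,3}, vertex k+1 ↦ k);
-- edge 14 (i.e. {0,3}) negative, all other edges positive.

t4sign : Fin 4 → Fin 4 → Sign
t4sign zero (suc (suc (suc zero))) = neg
t4sign (suc (suc (suc zero))) zero = neg
t4sign _ _ = pos

T4 : SGraph
T4 = record
  { V   = Fin 4
  ; Adj = λ u v → u ≢ v
  ; sgn = λ { {u} {v} _ → t4sign u v }
  }

-- The hexagonal tiling graph (honeycomb), in "brick wall" coordinates: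
-- vertices ℤ × ℤ; (x,y) ~ (x±1,y); and (x,y) ~ (x,y+1) when x+y is even.
-- This graph is isomorphic to the graph of the regular hexagonal tiling.

Even : ℤ → Set
Even n = + 2 ∣ n

HexAdj : ℤ × ℤ → ℤ × ℤ → Set
HexAdj (x , y) (x′ , y′) =
    (y ≡ y′ × (x′ ≡ x + + 1 ⊎ x ≡ x′ + + 1))
  ⊎ (x ≡ x′ × ((y′ ≡ y + + 1 × Even (x + y)) ⊎ (y ≡ y′ + + 1 × Even (x′ + y′))))

-- A 2-edge-colored hexagonal grid: the subgraph of the honeycomb induced by
-- a finite vertex set S, with signature s (s is read only on edges, where it
-- is required to be symmetric, i.e. it is a function of the unordered edge).
HexGrid : (S : List (ℤ × ℤ)) → (ℤ × ℤ → ℤ × ℤ → Sign) → SGraph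
HexGrid S s = record
  { V   = Σ (ℤ × ℤ) (λ p → p ∈ S)
  ; Adj = λ { (u , _) (v , _) → HexAdj u v }
  ; sgn = λ { {u , _} {v , _} _ → s u v }
  }

IsSignature : (ℤ × ℤ → ℤ × ℤ → Sign) → Set
IsSignature s = ∀ u v → HexAdj u v → s u v ≡ s v u

{-# OPTIONS --safe #-}
module Submission where

-- Every vertex (x , y) of the honeycomb lies on exactly one vertical edge (rung):
-- it goes up when x + y is even and down otherwise.  Colour the lower ends of
-- the rungs in row y by vertex 1 or 2 of T₄ according to the parity of y, and the
-- upper ends by 3 or 4.  All lower ends in a row then share one colour U, so the
-- switching  v ↦ P(v) · t(U , colour v),  with P a potential of the signs along
-- the row, makes every horizontal edge correct.  A rung from colour U of one row
-- to colour d of the next is then off by the factor t(1 , d) · t(2 , d), which is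
-- + for d = 3 and − for d = 4; the upper end picks d to correct its rung.

open import Defs
open import Data.Integer using (ℤ; +_; -[1+_]; _+_; ∣_∣; 1ℤ; pred) renaming (suc to sucℤ)
open import Data.Integer.Properties using (+-assoc; +-comm; pred-suc; +-commutativeSemigroup)
open import Algebra.Properties.CommutativeSemigroup +-commutativeSemigroup using (x∙yz≈y∙xz)
open import Data.Nat using (zero; suc; parity)
open import Data.Nat.Divisibility using (divides)
open import Data.Parity using (Parity; 0ℙ; 1ℙ; _⁻¹)
open import Data.Parity.Properties using (⁻¹-selfInverse; suc-homo-⁻¹; *-homo-*; *-zeroʳ)
open import Data.Fin using (Fin; zero; suc)
open import Data.Product using (Σ; _×_; _,_)
open import Data.Sum using (_⊎_; inj₁; inj₂)
open import Data.List using (List)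
open import Relation.Binary.PropositionalEquality

·-identityʳ : ∀ a → a · pos ≡ a
·-identityʳ pos = refl
·-identityʳ neg = refl

·-comm : ∀ a b → a · b ≡ b · a
·-comm pos b = sym (·-identityʳ b)
·-comm neg pos = refl
·-comm neg neg = refl

·-assoc : ∀ a b c → (a · b) · c ≡ a · (b · c)
·-assoc pos b c = refl
·-assoc neg pos c = refl
·-assoc neg neg pos = refl
·-assoc neg neg neg = refl

·-inverse : ∀ a → a · a ≡ pos
·-inverse pos = refl
·-inverse neg = refl

·-cancelˡ : ∀ a b → a · (a · b) ≡ b
·-cancelˡ a b = trans (sym (·-assoc a a b)) (cong (_· b) (·-inverse a))

·-cancelʳ : ∀ a b → (a · b) · b ≡ a
·-cancelʳ a b = trans (·-assoc a b b) (trans (cong (a ·_) (·-inverse b)) (·-identityʳ a))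

parityℤ : ℤ → Parity
parityℤ z = parity ∣ z ∣

parityℤ-suc : ∀ z → parityℤ (sucℤ z) ≡ parityℤ z ⁻¹
parityℤ-suc (+ n) = sym (⁻¹-selfInverse (suc-homo-⁻¹ n))
parityℤ-suc -[1+ zero ] = refl
parityℤ-suc -[1+ suc n ] = sym (⁻¹-selfInverse (suc-homo-⁻¹ n))

parityℤ-sucˡ : ∀ x y → parityℤ (sucℤ x + y) ≡ parityℤ (x + y) ⁻¹
parityℤ-sucˡ x y = trans (cong parityℤ (+-assoc 1ℤ x y)) (parityℤ-suc (x + y))

parityℤ-sucʳ : ∀ x y → parityℤ (x + sucℤ y) ≡ parityℤ (x + y) ⁻¹
parityℤ-sucʳ x y = trans (cong parityℤ (x∙yz≈y∙xz x 1ℤ y)) (parityℤ-suc (x + y))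

Even⇒parityℤ≡0ℙ : ∀ z → Even z → parityℤ z ≡ 0ℙ
Even⇒parityℤ≡0ℙ _ (divides q eq) =
  trans (cong parity eq) (trans (*-homo-* q 2) (*-zeroʳ (parity q)))

potential : (ℤ → Sign) → ℤ → Sign
potential f (+ zero) = pos
potential f (+ suc n) = potential f (+ n) · f (+ n)
potential f -[1+ zero ] = f -[1+ zero ]
potential f -[1+ suc n ] = f -[1+ suc n ] · potential f -[1+ n ]

potential-step : ∀ f x → potential f x · potential f (sucℤ x) ≡ f x
potential-step f (+ n) = ·-cancelˡ (potential f (+ n)) (f (+ n))
potential-step f -[1+ zero ] = ·-identityʳ (f -[1+ zero ])
potential-step f -[1+ suc n ] = ·-cancelʳ (f -[1+ suc n ]) (potential f -[1+ n ])

record SignedEdge (H : SGraph) (a b : V H) (σ : Sign) : Set where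
  constructor edge
  field
    adjacent : Adj H a b
    signed   : sgn H adjacent ≡ σ

IsSymmetric : SGraph → Set
IsSymmetric H = ∀ {a b} (e : Adj H a b) → SignedEdge H b a (sgn H e)

reverse : ∀ H → IsSymmetric H → ∀ {a b σ} → SignedEdge H a b σ → SignedEdge H b a σ
reverse H H-sym (edge e refl) = H-sym e

ρ-symmetric : ∀ H → IsSymmetric H → IsSymmetric (ρ H)
ρ-symmetric H H-sym {a , i} {b , j} e with H-sym e
... | edge e′ e′≡e = edge e′ (cong₂ _·_ (·-comm j i) e′≡e)

t4sign-sym : ∀ a b → t4sign a b ≡ t4sign b a
t4sign-sym zero zero = refl
t4sign-sym zero (suc zero) = refl
t4sign-sym zero (suc (suc zero)) = refl
t4sign-sym zero (suc (suc (suc zero))) = refl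
t4sign-sym (suc zero) zero = refl
t4sign-sym (suc zero) (suc zero) = refl
t4sign-sym (suc zero) (suc (suc zero)) = refl
t4sign-sym (suc zero) (suc (suc (suc zero))) = refl
t4sign-sym (suc (suc zero)) zero = refl
t4sign-sym (suc (suc zero)) (suc zero) = refl
t4sign-sym (suc (suc zero)) (suc (suc zero)) = refl
t4sign-sym (suc (suc zero)) (suc (suc (suc zero))) = refl
t4sign-sym (suc (suc (suc zero))) zero = refl
t4sign-sym (suc (suc (suc zero))) (suc zero) = refl
t4sign-sym (suc (suc (suc zero))) (suc (suc zero)) = refl
t4sign-sym (suc (suc (suc zero))) (suc (suc (suc zero))) = refl

T4-symmetric : IsSymmetric T4
T4-symmetric {a} {b} a≢b = edge (λ b≡a → a≢b (sym b≡a)) (t4sign-sym b a)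

ρT4-reverse : ∀ {a b σ} → SignedEdge (ρ T4) a b σ → SignedEdge (ρ T4) b a σ
ρT4-reverse = reverse (ρ T4) (ρ-symmetric T4 T4-symmetric)

up : Parity → Fin 4
up 0ℙ = zero
up 1ℙ = suc zero

down : Sign → Fin 4
down pos = suc (suc zero)
down neg = suc (suc (suc zero))

up≢down : ∀ p δ → up p ≢ down δ
up≢down 0ℙ pos ()
up≢down 0ℙ neg ()
up≢down 1ℙ pos ()
up≢down 1ℙ neg ()

t4sign-twist : ∀ p δ → t4sign (up (p ⁻¹)) (down δ) · t4sign (up p) (down δ) ≡ δ
t4sign-twist 0ℙ pos = refl
t4sign-twist 0ℙ neg = refl
t4sign-twist 1ℙ pos = refl
t4sign-twist 1ℙ neg = refl

rowEdge : ∀ {U d π π′ σ} → U ≢ d → π · π′ ≡ σ →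
          SignedEdge (ρ T4) (U , π) (d , π′ · t4sign U d) σ
rowEdge {U} {d} {π} {π′} {σ} U≢d π·π′≡σ = edge U≢d (begin
  (π · (π′ · t)) · t  ≡⟨ ·-assoc π (π′ · t) t ⟩
  π · ((π′ · t) · t)  ≡⟨ cong (π ·_) (·-cancelʳ π′ t) ⟩
  π · π′              ≡⟨ π·π′≡σ ⟩
  σ                   ∎)
  where
  open ≡-Reasoning
  t = t4sign U d

rungEdge : ∀ p {π π′ σ δ} → δ ≡ (π · π′) · σ →
           SignedEdge (ρ T4) (up p , π) (down δ , π′ · t4sign (up (p ⁻¹)) (down δ)) σ
rungEdge p {π} {π′} {σ} {δ} δ≡ = edge (up≢down p δ) (begin
  (π · (π′ · t′)) · t        ≡⟨ cong (_· t) (sym (·-assoc π π′ t′)) ⟩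
  ((π · π′) · t′) · t        ≡⟨ ·-assoc (π · π′) t′ t ⟩
  (π · π′) · (t′ · t)        ≡⟨ cong ((π · π′) ·_) (trans (t4sign-twist p δ) δ≡) ⟩
  (π · π′) · ((π · π′) · σ)  ≡⟨ ·-cancelˡ (π · π′) σ ⟩
  σ                          ∎)
  where
  open ≡-Reasoning
  t = t4sign (up p) (down δ)
  t′ = t4sign (up (p ⁻¹)) (down δ)

data Link : ℤ × ℤ → ℤ × ℤ → Set where
  row  : ∀ x y → Link (x , y) (sucℤ x , y)
  rung : ∀ x y → Even (x + y) → Link (x , y) (x , sucℤ y)

+1≡suc : ∀ z → z + + 1 ≡ sucℤ z
+1≡suc z = +-comm z 1ℤ

link : ∀ {u v} → HexAdj u v → Link u v ⊎ Link v u
link {x , y} (inj₁ (refl , inj₁ refl)) =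
  inj₁ (subst (λ x′ → Link (x , y) (x′ , y)) (sym (+1≡suc x)) (row x y))
link {_} {x , y} (inj₁ (refl , inj₂ refl)) =
  inj₂ (subst (λ x′ → Link (x , y) (x′ , y)) (sym (+1≡suc x)) (row x y))
link {x , y} (inj₂ (refl , inj₁ (refl , even))) =
  inj₁ (subst (λ y′ → Link (x , y) (x , y′)) (sym (+1≡suc y)) (rung x y even))
link {_} {x , y} (inj₂ (refl , inj₂ (refl , even))) =
  inj₂ (subst (λ y′ → Link (x , y) (x , y′)) (sym (+1≡suc y)) (rung x y even))

module HoneycombColouring (s : ℤ × ℤ → ℤ × ℤ → Sign) where

  rowSign : ℤ → ℤ → Sign
  rowSign y x = s (x , y) (sucℤ x , y)

  rowPotential : ℤ → ℤ → Sign
  rowPotential y = potential (rowSign y)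

  rungSign : ℤ → ℤ → Sign
  rungSign x y = (rowPotential (pred y) x · rowPotential y x) · s (x , pred y) (x , y)

  image : Parity → ℤ → ℤ → Fin 4 × Sign
  image 0ℙ x y = up (parityℤ y) , rowPotential y x
  image 1ℙ x y = down (rungSign x y) ,
                 rowPotential y x · t4sign (up (parityℤ y)) (down (rungSign x y))

  φ : ℤ × ℤ → Fin 4 × Sign
  φ (x , y) = image (parityℤ (x + y)) x y

  rungSign-suc : ∀ x y →
    rungSign x (sucℤ y) ≡ (rowPotential y x · rowPotential (sucℤ y) x) · s (x , y) (x , sucℤ y)
  rungSign-suc x y rewrite pred-suc y = refl

  φ-link : ∀ {u v} → Link u v → SignedEdge (ρ T4) (φ u) (φ v) (s u v)
  φ-link (row x y) rewrite parityℤ-sucˡ x y with parityℤ (x + y)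
  ... | 0ℙ = rowEdge (up≢down (parityℤ y) (rungSign (sucℤ x) y))
                     (potential-step (rowSign y) x)
  ... | 1ℙ = ρT4-reverse (rowEdge (up≢down (parityℤ y) (rungSign x y))
    (trans (·-comm (rowPotential y (sucℤ x)) (rowPotential y x)) (potential-step (rowSign y) x)))
  φ-link (rung x y even)
    rewrite parityℤ-sucʳ x y | Even⇒parityℤ≡0ℙ (x + y) even | parityℤ-suc y =
    rungEdge (parityℤ y) (rungSign-suc x y)

  φ-hom : IsSignature s → ∀ u v → HexAdj u v → SignedEdge (ρ T4) (φ u) (φ v) (s u v)
  φ-hom s-sym u v uv with link uv
  ... | inj₁ l = φ-link l
  ... | inj₂ l = subst (SignedEdge (ρ T4) (φ u) (φ v)) (sym (s-sym u v uv))
                       (ρT4-reverse (φ-link l))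

lemma7 : (S : List (ℤ × ℤ)) (s : ℤ × ℤ → ℤ × ℤ → Sign) → IsSignature s →
         Σ (V (HexGrid S s) → V (ρ T4)) (IsHom (HexGrid S s) (ρ T4))
lemma7 S s s-sym = (λ (u , _) → φ u) , λ { {u , _} {v , _} uv →
  let edge e e-sign = φ-hom s-sym u v uv in e , e-sign }
  where open HoneycombColouring s
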